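{- Let $p$ be a prime, $n\ge 2$ an integer, $H=\langle h\rangle$ and $P=\langle g\rangle$ cyclic groups of orders $n+2$ and $p$, $G=H\times P$, and let $\gamma_1,\gamma_2$ be integers. Let $R\subseteq G$ be an $$\left(n+2,\,p,\,n,\,\tfrac{n-\gamma_2-2}{p}+\gamma_2,\,0,\,\tfrac{n-\gamma_1-1}{p}+\gamma_1,\,\tfrac{n-\gamma_2-2}{p},\,\tfrac{n-\gamma_1-1}{p}\right)$$ PDPDS in $G$ relative to $H$ and $P$. For $i=0,1,\ldots,p-1$ let $s_i$ be the number of elements of $R$ of the form $h^ag^i$. Then $$(p-1)\sum_{j=0}^{p-1}s_js_{j-i}+\sum_{j=0}^{p-1}s_j^2=n^2$$ for each $i=1,2,\ldots,\lceil\frac{p-1}{2}\rceil$, where subscripts are taken modulo $p$.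
   Context: With $H=\langle h\rangle$ cyclic of order $n+2$, $P=\langle g\rangle$ cyclic of order $p$ and $G=H\times P$, a subset $R\subseteq G$ with $|R|=k$ is an $(n+2,p,k,\lambda_1,\lambda_2,\lambda_3,\mu_1,\mu_2)$ partial direct product difference set (PDPDS) in $G$ relative to $H$ and $P$ if the quotients $r_1r_2^{ -1}$, $r_1,r_2\in R$, $r_1\ne r_2$, represent: each of $h^2,\ldots,h^n$ exactly $\lambda_1$ times; each non-identity element of $P$ exactly $\lambda_2$ times; each of $h,h^{n+1}$ exactly $\lambda_3$ times; each $h^ag^b$ with $2\le a\le n$, $1\le b\le p-1$ exactly $\mu_1$ times; each $h^ag^b$ with $a\in\{1,n+1\}$, $1\le b\le p-1$ exactly $\mu_2$ times (parameters are nonnegative integers). -}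

module Defs where

open import Data.Nat using (ℕ; zero; suc; _+_; _*_; _∸_; _≤_; _%_)
open import Data.Nat.DivMod using (m%n<n)
open import Data.Fin using (Fin; toℕ; fromℕ<; _≟_)
open import Data.Bool using (Bool; _∧_; not)
open import Data.Product using (_×_; _,_; proj₁; proj₂)
open import Data.Sum using (_⊎_)
open import Data.List using (List; length; filterᵇ; cartesianProduct; allFin; map)
open import Data.Nat.ListAction using (sum)
open import Relation.Nullary.Decidable using (⌊_⌋)
open import Relation.Binary.PropositionalEquality using (_≡_; _≢_)

_⊖_ : ∀ {m} → Fin m → Fin m → Fin m
_⊖_ {suc k} a b = fromℕ< (m%n<n ((toℕ a + suc k) ∸ toℕ b) (suc k))

-- G = H × P with H = Z/(n+2), P = Z/p; element (a , b) stands for h^a g^b.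
G : ℕ → ℕ → Set
G n p = Fin (n + 2) × Fin p

quot : ∀ {n p} → G n p → G n p → G n p
quot (a₁ , b₁) (a₂ , b₂) = (a₁ ⊖ a₂) , (b₁ ⊖ b₂)

eqG : ∀ {n p} → G n p → G n p → Bool
eqG (a₁ , b₁) (a₂ , b₂) = ⌊ a₁ ≟ a₂ ⌋ ∧ ⌊ b₁ ≟ b₂ ⌋

elems : ∀ n p → List (G n p)
elems n p = cartesianProduct (allFin (n + 2)) (allFin p)

Subset : ℕ → ℕ → Set
Subset n p = G n p → Bool

card : ∀ {n p} → Subset n p → ℕ
card {n} {p} R = length (filterᵇ R (elems n p))

reps : ∀ {n p} → Subset n p → G n p → ℕ
reps {n} {p} R x = length (filterᵇ
  (λ rr → R (proj₁ rr) ∧ R (proj₂ rr) ∧ not (eqG (proj₁ rr) (proj₂ rr))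
          ∧ eqG (quot (proj₁ rr) (proj₂ rr)) x)
  (cartesianProduct (elems n p) (elems n p)))

Edge : ℕ → ℕ → Set
Edge n a = (a ≡ 1) ⊎ (a ≡ suc n)

Mid : ℕ → ℕ → Set
Mid n a = (2 ≤ a) × (a ≤ n)

record PDPDS (n p k λ₁ λ₂ λ₃ μ₁ μ₂ : ℕ) (R : Subset n p) : Set where
  field
    size  : card R ≡ k
    repλ₁ : ∀ (a : Fin (n + 2)) (b : Fin p) → Mid n (toℕ a) → toℕ b ≡ 0 → reps R (a , b) ≡ λ₁
    repλ₂ : ∀ (a : Fin (n + 2)) (b : Fin p) → toℕ a ≡ 0 → toℕ b ≢ 0 → reps R (a , b) ≡ λ₂
    repλ₃ : ∀ (a : Fin (n + 2)) (b : Fin p) → Edge n (toℕ a) → toℕ b ≡ 0 → reps R (a , b) ≡ λ₃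
    repμ₁ : ∀ (a : Fin (n + 2)) (b : Fin p) → Mid n (toℕ a) → toℕ b ≢ 0 → reps R (a , b) ≡ μ₁
    repμ₂ : ∀ (a : Fin (n + 2)) (b : Fin p) → Edge n (toℕ a) → toℕ b ≢ 0 → reps R (a , b) ≡ μ₂

s : ∀ {n p} → Subset n p → Fin p → ℕ
s {n} {p} R i = length (filterᵇ (λ x → R x ∧ ⌊ proj₂ x ≟ i ⌋) (elems n p))

ΣFin : ∀ p → (Fin p → ℕ) → ℕ
ΣFin p f = sum (map f (allFin p))

-- Σⱼ s_j s_{j−i} counts the ordered pairs (x, y) ∈ R × R with x y⁻¹ ∈ H gⁱ. For i ≠ 0 such
-- pairs are distinct, so their number is Σ_a reps(hᵃ gⁱ) = λ₂ + 2μ₂ + (n−1)μ₁; for i = 0 the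
-- n diagonal pairs are added to Σ_a reps(hᵃ) = 2λ₃ + (n−1)λ₁, as x y⁻¹ = 1 forces x = y.
-- With λ₂ = 0, (p−1)μ₁ + λ₁ = n−2 and (p−1)μ₂ + λ₃ = n−1, the left-hand side becomes
-- 2(n−1) + (n−1)(n−2) + n = n².

module Submission where

open import Data.Bool using (Bool; true; false; _∧_; not)
open import Data.Bool.Properties using (∧-zeroʳ; ∧-inverseˡ)
open import Data.Fin using (Fin; zero; suc; toℕ; _≟_)
open import Data.Fin.Properties using (toℕ-injective; toℕ-fromℕ<; toℕ<n)
open import Data.Integer using (ℤ; +_) renaming (_+_ to _+ℤ_; _*_ to _*ℤ_; _-_ to _-ℤ_)
open import Data.Integer.Properties using (pos-+; pos-*; +-injective)
import Data.Integer.Tactic.RingSolver as ℤ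
open import Data.List using (List; []; _∷_; _++_; length; filterᵇ; cartesianProduct; allFin; map; tabulate)
open import Data.List.Properties using (map-++; map-∘; map-tabulate)
open import Data.Nat using (ℕ; zero; suc; _+_; _*_; _∸_; _≤_; _%_; z≤n; s≤s; ⌈_/2⌉)
import Data.Nat.Tactic.RingSolver as ℕ
open import Data.Nat.DivMod using (%-distribˡ-+; [m+n]%n≡m%n; m<n⇒m%n≡m; m%n<n)
open import Data.Nat.Primality using (Prime)
open import Data.Nat.ListAction using () renaming (sum to listSum)
open import Data.Nat.ListAction.Properties using (sum-++)
open import Data.Nat.Properties
  using ( +-*-semiring; +-identityʳ; *-identityʳ; +-comm; +-assoc; *-assoc; *-zeroʳ
        ; m∸n+n≡m; m+[n∸m]≡n; <⇒≤; ≤-trans; m≤n+m)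
open import Data.Product using (_×_; _,_; proj₁; proj₂)
open import Data.Sum using (inj₁; inj₂)
open import Function using (_∘_; _⇔_; mk⇔)
open import Relation.Binary.PropositionalEquality
  using (_≡_; _≢_; refl; sym; trans; cong; cong₂; module ≡-Reasoning)
open import Relation.Nullary.Decidable using (Dec; ⌊_⌋; isYes≗does; does-⇔; ⌊⌋-map′)

open import Algebra.Properties.Semiring.Sum +-*-semiring
  using (sum-syntax; sum-cong-≗; sum-replicate-zero; ∑-distrib-+; ∑-comm; *-distribˡ-sum; *-distribʳ-sum)

open import Defs

ι : Bool → ℕ
ι true  = 1
ι false = 0

ι-∧ : ∀ a b → ι (a ∧ b) ≡ ι a * ι b
ι-∧ true  b = sym (+-identityʳ (ι b))
ι-∧ false b = refl

ι-∧-interchange : ∀ a d b e → ι (a ∧ d) * ι (b ∧ e) ≡ ι d * ι (a ∧ b ∧ e)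
ι-∧-interchange false d     b e = sym (*-zeroʳ (ι d))
ι-∧-interchange true  false b e = refl
ι-∧-interchange true  true  b e = refl

ι-∧-pull : ∀ a b c u v → ι (a ∧ b ∧ c ∧ u ∧ v) ≡ ι u * ι (a ∧ b ∧ c ∧ v)
ι-∧-pull true  true  true  u v = ι-∧ u v
ι-∧-pull true  true  false u v = sym (*-zeroʳ (ι u))
ι-∧-pull true  false c     u v = sym (*-zeroʳ (ι u))
ι-∧-pull false b     c     u v = sym (*-zeroʳ (ι u))

ι-∧-dup : ∀ a c → ι (a ∧ a ∧ c) ≡ ι a * ι c
ι-∧-dup true  c = sym (+-identityʳ (ι c))
ι-∧-dup false c = refl

ι-split : ∀ a b e c → ι (a ∧ b ∧ c) ≡ ι (a ∧ b ∧ not e ∧ c) + ι e * ι (a ∧ b ∧ c)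
ι-split a     b     false c = sym (+-identityʳ (ι (a ∧ b ∧ c)))
ι-split true  true  true  c = sym (+-identityʳ (ι c))
ι-split true  false true  c = refl
ι-split false b     true  c = refl

⌊⌋-⇔ : {A B : Set} → A ⇔ B → (a? : Dec A) (b? : Dec B) → ⌊ a? ⌋ ≡ ⌊ b? ⌋
⌊⌋-⇔ A⇔B a? b? = trans (isYes≗does a?) (trans (does-⇔ A⇔B a? b?) (sym (isYes≗does b?)))

δ : ∀ {m} → Fin m → Fin m → ℕ
δ a b = ι ⌊ a ≟ b ⌋

∑-δ : ∀ {m} (a : Fin m) (f : Fin m → ℕ) → ∑[ b < m ] (δ a b * f b) ≡ f a
∑-δ {suc m} zero    f = trans (cong₂ _+_ (+-identityʳ (f zero)) (sum-replicate-zero m)) (+-identityʳ (f zero))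
∑-δ {suc m} (suc a) f =
  trans (sum-cong-≗ λ b → cong (λ d → ι d * f (suc b)) (⌊⌋-map′ _ _ (a ≟ b))) (∑-δ a (f ∘ suc))

module _ {k : ℕ} where

  %-cancelʳ-+ : ∀ {b} x y → b ≤ suc k → (x + b) % suc k ≡ (y + b) % suc k → x % suc k ≡ y % suc k
  %-cancelʳ-+ {b} x y b≤ eq = begin
    x % m                           ≡⟨ undo-+ x ⟩
    ((x + b) % m + (m ∸ b) % m) % m ≡⟨ cong (λ z → (z + (m ∸ b) % m) % m) eq ⟩
    ((y + b) % m + (m ∸ b) % m) % m ≡⟨ undo-+ y ⟨
    y % m                           ∎
    where
    open ≡-Reasoning
    m = suc k
    undo-+ : ∀ z → z % m ≡ ((z + b) % m + (m ∸ b) % m) % m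
    undo-+ z = begin
      z % m                           ≡⟨ [m+n]%n≡m%n z m ⟨
      (z + m) % m                     ≡⟨ cong (λ w → (z + w) % m) (m+[n∸m]≡n b≤) ⟨
      (z + (b + (m ∸ b))) % m         ≡⟨ cong (_% m) (+-assoc z b (m ∸ b)) ⟨
      (z + b + (m ∸ b)) % m           ≡⟨ %-distribˡ-+ (z + b) (m ∸ b) m ⟩
      ((z + b) % m + (m ∸ b) % m) % m ∎

  ⊖-+ : (a b : Fin (suc k)) → (toℕ (a ⊖ b) + toℕ b) % suc k ≡ toℕ a
  ⊖-+ a b = begin
    (toℕ (a ⊖ b) + toℕ b) % m    ≡⟨ cong (λ z → (z + toℕ b) % m) (toℕ-fromℕ< (m%n<n d m)) ⟩
    (d % m + toℕ b) % m          ≡⟨ cong (λ z → (d % m + z) % m) (m<n⇒m%n≡m (toℕ<n b)) ⟨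
    (d % m + toℕ b % m) % m      ≡⟨ %-distribˡ-+ d (toℕ b) m ⟨
    (d + toℕ b) % m              ≡⟨ cong (_% m) (m∸n+n≡m (≤-trans (<⇒≤ (toℕ<n b)) (m≤n+m m (toℕ a)))) ⟩
    (toℕ a + m) % m              ≡⟨ [m+n]%n≡m%n (toℕ a) m ⟩
    toℕ a % m                    ≡⟨ m<n⇒m%n≡m (toℕ<n a) ⟩
    toℕ a                        ∎
    where
    open ≡-Reasoning
    m = suc k
    d = toℕ a + m ∸ toℕ b

  ⊖-unique : (a b c : Fin (suc k)) → (toℕ c + toℕ b) % suc k ≡ toℕ a → c ≡ a ⊖ b
  ⊖-unique a b c eq = toℕ-injective (begin
    toℕ c               ≡⟨ m<n⇒m%n≡m (toℕ<n c) ⟨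
    toℕ c % suc k
      ≡⟨ %-cancelʳ-+ (toℕ c) (toℕ (a ⊖ b)) (<⇒≤ (toℕ<n b)) (trans eq (sym (⊖-+ a b))) ⟩
    toℕ (a ⊖ b) % suc k ≡⟨ m<n⇒m%n≡m (toℕ<n (a ⊖ b)) ⟩
    toℕ (a ⊖ b)         ∎)
    where open ≡-Reasoning

  ⊖-swap : {a b c : Fin (suc k)} → a ⊖ b ≡ c → a ⊖ c ≡ b
  ⊖-swap {a} {b} {c} refl = sym (⊖-unique a (a ⊖ b) b
    (trans (cong (_% suc k) (+-comm (toℕ b) (toℕ (a ⊖ b)))) (⊖-+ a b)))

  ⊖-identityʳ : (a : Fin (suc k)) → a ⊖ zero ≡ a
  ⊖-identityʳ a = sym (⊖-unique a zero a
    (trans (cong (_% suc k) (+-identityʳ (toℕ a))) (m<n⇒m%n≡m (toℕ<n a))))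

  ⊖-self : (a : Fin (suc k)) → a ⊖ a ≡ zero
  ⊖-self a = sym (⊖-unique a a zero (m<n⇒m%n≡m (toℕ<n a)))

  ⊖≡zero⇒≡ : {a b : Fin (suc k)} → a ⊖ b ≡ zero → a ≡ b
  ⊖≡zero⇒≡ {a} eq = trans (sym (⊖-identityʳ a)) (⊖-swap eq)

  ⌊≟⊖⌋-swap : (a b c : Fin (suc k)) → ⌊ b ≟ a ⊖ c ⌋ ≡ ⌊ a ⊖ b ≟ c ⌋
  ⌊≟⊖⌋-swap a b c =
    ⌊⌋-⇔ (mk⇔ (λ eq → ⊖-swap (sym eq)) (λ eq → sym (⊖-swap eq))) (b ≟ a ⊖ c) (a ⊖ b ≟ c)

  ⌊⊖≟zero⌋ : (a b : Fin (suc k)) → ⌊ a ⊖ b ≟ zero ⌋ ≡ ⌊ a ≟ b ⌋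
  ⌊⊖≟zero⌋ a b = ⌊⌋-⇔ (mk⇔ ⊖≡zero⇒≡ (λ { refl → ⊖-self a })) (a ⊖ b ≟ zero) (a ≟ b)

length-filterᵇ : {A : Set} (P : A → Bool) (xs : List A) → length (filterᵇ P xs) ≡ listSum (map (ι ∘ P) xs)
length-filterᵇ P []       = refl
length-filterᵇ P (x ∷ xs) with P x
... | true  = cong suc (length-filterᵇ P xs)
... | false = length-filterᵇ P xs

listSum-tabulate : ∀ {m} (f : Fin m → ℕ) → listSum (tabulate f) ≡ ∑[ i < m ] f i
listSum-tabulate {zero}  f = refl
listSum-tabulate {suc m} f = cong₂ _+_ refl (listSum-tabulate (f ∘ suc))

listSum-map-allFin : ∀ m (f : Fin m → ℕ) → listSum (map f (allFin m)) ≡ ∑[ i < m ] f i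
listSum-map-allFin m f = trans (cong listSum (map-tabulate (λ i → i) f)) (listSum-tabulate f)

listSum-map-cartesianProduct : {A B : Set} (f : A × B → ℕ) (xs : List A) (ys : List B) →
  listSum (map f (cartesianProduct xs ys)) ≡ listSum (map (λ x → listSum (map (λ y → f (x , y)) ys)) xs)
listSum-map-cartesianProduct f []       ys = refl
listSum-map-cartesianProduct f (x ∷ xs) ys = begin
  listSum (map f (map (x ,_) ys ++ cartesianProduct xs ys))
    ≡⟨ cong listSum (map-++ f (map (x ,_) ys) (cartesianProduct xs ys)) ⟩
  listSum (map f (map (x ,_) ys) ++ map f (cartesianProduct xs ys))
    ≡⟨ sum-++ (map f (map (x ,_) ys)) (map f (cartesianProduct xs ys)) ⟩
  listSum (map f (map (x ,_) ys)) + listSum (map f (cartesianProduct xs ys))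
    ≡⟨ cong₂ _+_ (cong listSum (sym (map-∘ ys))) (listSum-map-cartesianProduct f xs ys) ⟩
  listSum (map (λ y → f (x , y)) ys) + listSum (map (λ x → listSum (map (λ y → f (x , y)) ys)) xs) ∎
  where open ≡-Reasoning

module _ {n p : ℕ} where

  ∑G : (G n p → ℕ) → ℕ
  ∑G f = ∑[ a < n + 2 ] ∑[ b < p ] f (a , b)

  ∑G-cong : {f g : G n p → ℕ} → (∀ x → f x ≡ g x) → ∑G f ≡ ∑G g
  ∑G-cong eq = sum-cong-≗ λ a → sum-cong-≗ λ b → eq (a , b)

  ∑G-distrib-+ : (f g : G n p → ℕ) → ∑G (λ x → f x + g x) ≡ ∑G f + ∑G g
  ∑G-distrib-+ f g = trans (sum-cong-≗ λ a → ∑-distrib-+ (λ b → f (a , b)) (λ b → g (a , b)))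
    (∑-distrib-+ (λ a → ∑[ b < p ] f (a , b)) (λ a → ∑[ b < p ] g (a , b)))

  ∑G²-distrib-+ : (f g : G n p → G n p → ℕ) →
    ∑G (λ x → ∑G (λ y → f x y + g x y)) ≡ ∑G (λ x → ∑G (f x)) + ∑G (λ x → ∑G (g x))
  ∑G²-distrib-+ f g = trans (∑G-cong λ x → ∑G-distrib-+ (f x) (g x))
    (∑G-distrib-+ (λ x → ∑G (f x)) (λ x → ∑G (g x)))

  *-distribˡ-∑G : (c : ℕ) (f : G n p → ℕ) → c * ∑G f ≡ ∑G (λ x → c * f x)
  *-distribˡ-∑G c f = trans (*-distribˡ-sum c (λ a → ∑[ b < p ] f (a , b)))
    (sum-cong-≗ λ a → *-distribˡ-sum c (λ b → f (a , b)))

  *-distribʳ-∑G : (c : ℕ) (f : G n p → ℕ) → ∑G f * c ≡ ∑G (λ x → f x * c)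
  *-distribʳ-∑G c f = trans (*-distribʳ-sum c (λ a → ∑[ b < p ] f (a , b)))
    (sum-cong-≗ λ a → *-distribʳ-sum c (λ b → f (a , b)))

  ∑-∑G-comm : ∀ m (F : Fin m → G n p → ℕ) → ∑[ i < m ] ∑G (F i) ≡ ∑G (λ x → ∑[ i < m ] F i x)
  ∑-∑G-comm m F =
    trans (∑-comm (λ i a → ∑[ b < p ] F i (a , b))) (sum-cong-≗ λ a → ∑-comm (λ i b → F i (a , b)))

  ∑G-δ : (x : G n p) (f : G n p → ℕ) → ∑G (λ y → ι (eqG x y) * f y) ≡ f x
  ∑G-δ (a , b) f = begin
    ∑G (λ y → ι (eqG (a , b) y) * f y)
      ≡⟨ ∑G-cong (λ y → cong (_* f y) (ι-∧ ⌊ a ≟ proj₁ y ⌋ _)) ⟩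
    ∑G (λ y → δ a (proj₁ y) * δ b (proj₂ y) * f y)
      ≡⟨ ∑G-cong (λ y → *-assoc (δ a (proj₁ y)) _ _) ⟩
    ∑[ a′ < n + 2 ] ∑[ b′ < p ] (δ a a′ * (δ b b′ * f (a′ , b′)))
      ≡⟨ sum-cong-≗ (λ a′ → *-distribˡ-sum (δ a a′) (λ b′ → δ b b′ * f (a′ , b′))) ⟨
    ∑[ a′ < n + 2 ] (δ a a′ * ∑[ b′ < p ] (δ b b′ * f (a′ , b′)))
      ≡⟨ sum-cong-≗ (λ a′ → cong (δ a a′ *_) (∑-δ b (λ b′ → f (a′ , b′)))) ⟩
    ∑[ a′ < n + 2 ] (δ a a′ * f (a′ , b))
      ≡⟨ ∑-δ a _ ⟩
    f (a , b) ∎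
    where open ≡-Reasoning

  ∑-∑G²-δ : ∀ {m} (t : G n p → G n p → Fin m) (g : G n p → G n p → Fin m → ℕ) →
    ∑[ i < m ] ∑G (λ x → ∑G (λ y → δ (t x y) i * g x y i)) ≡ ∑G (λ x → ∑G (λ y → g x y (t x y)))
  ∑-∑G²-δ {m} t g = trans (∑-∑G-comm m _) (∑G-cong λ x →
    trans (∑-∑G-comm m _) (∑G-cong λ y → ∑-δ (t x y) (g x y)))

  listSum-map-elems : (f : G n p → ℕ) → listSum (map f (elems n p)) ≡ ∑G f
  listSum-map-elems f = trans (listSum-map-cartesianProduct f (allFin (n + 2)) (allFin p))
    (trans (listSum-map-allFin (n + 2) _) (sum-cong-≗ λ a → listSum-map-allFin p (λ b → f (a , b))))

  length-filterᵇ-elems : (P : G n p → Bool) → length (filterᵇ P (elems n p)) ≡ ∑G (ι ∘ P)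
  length-filterᵇ-elems P = trans (length-filterᵇ P (elems n p)) (listSum-map-elems _)

  length-filterᵇ-elems² : (Q : G n p → G n p → Bool) →
    length (filterᵇ (λ xy → Q (proj₁ xy) (proj₂ xy)) (cartesianProduct (elems n p) (elems n p)))
      ≡ ∑G (λ x → ∑G (λ y → ι (Q x y)))
  length-filterᵇ-elems² Q = begin
    length (filterᵇ Q′ (cartesianProduct (elems n p) (elems n p)))
      ≡⟨ length-filterᵇ Q′ (cartesianProduct (elems n p) (elems n p)) ⟩
    listSum (map (ι ∘ Q′) (cartesianProduct (elems n p) (elems n p)))
      ≡⟨ listSum-map-cartesianProduct (ι ∘ Q′) (elems n p) (elems n p) ⟩
    listSum (map (λ x → listSum (map (λ y → ι (Q x y)) (elems n p))) (elems n p))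
      ≡⟨ listSum-map-elems _ ⟩
    ∑G (λ x → listSum (map (λ y → ι (Q x y)) (elems n p)))
      ≡⟨ ∑G-cong (λ x → listSum-map-elems _) ⟩
    ∑G (λ x → ∑G (λ y → ι (Q x y))) ∎
    where
    open ≡-Reasoning
    Q′ : G n p × G n p → Bool
    Q′ xy = Q (proj₁ xy) (proj₂ xy)

  ∑G-zero : ∑G (λ _ → 0) ≡ 0
  ∑G-zero = sym (*-distribˡ-∑G 0 (λ _ → 0))

pairsWith : ∀ {n p} → Subset n p → (G n p → G n p → Bool) → ℕ
pairsWith R Q = ∑G λ x → ∑G λ y → ι (R x ∧ R y ∧ Q x y)

pairsWith-cong : ∀ {n p} (R : Subset n p) {Q Q′ : G n p → G n p → Bool} →
  (∀ x y → Q x y ≡ Q′ x y) → pairsWith R Q ≡ pairsWith R Q′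
pairsWith-cong R eq = ∑G-cong λ x → ∑G-cong λ y → cong (λ b → ι (R x ∧ R y ∧ b)) (eq x y)

∑-s*s : ∀ {n p} (R : Subset n p) (h : Fin p → Fin p) →
  ∑[ j < p ] (s R j * s R (h j)) ≡ pairsWith R (λ x y → ⌊ proj₂ y ≟ h (proj₂ x) ⌋)
∑-s*s {n} {p} R h = begin
  ∑[ j < p ] (s R j * s R (h j))
    ≡⟨ sum-cong-≗ (λ j → s*s j (h j)) ⟩
  ∑[ j < p ] ∑G (λ x → ∑G (λ y → δ (proj₂ x) j * ι (R x ∧ R y ∧ ⌊ proj₂ y ≟ h j ⌋)))
    ≡⟨ ∑-∑G²-δ (λ x y → proj₂ x) (λ x y j → ι (R x ∧ R y ∧ ⌊ proj₂ y ≟ h j ⌋)) ⟩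
  pairsWith R (λ x y → ⌊ proj₂ y ≟ h (proj₂ x) ⌋) ∎
  where
  open ≡-Reasoning
  inP : Fin p → G n p → Bool
  inP j x = R x ∧ ⌊ proj₂ x ≟ j ⌋
  s*s : ∀ j k →
    s R j * s R k ≡ ∑G (λ x → ∑G (λ y → δ (proj₂ x) j * ι (R x ∧ R y ∧ ⌊ proj₂ y ≟ k ⌋)))
  s*s j k = begin
    s R j * s R k
      ≡⟨ cong₂ _*_ (length-filterᵇ-elems (inP j)) (length-filterᵇ-elems (inP k)) ⟩
    ∑G (ι ∘ inP j) * ∑G (ι ∘ inP k)
      ≡⟨ *-distribʳ-∑G (∑G (ι ∘ inP k)) (ι ∘ inP j) ⟩
    ∑G (λ x → ι (inP j x) * ∑G (ι ∘ inP k))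
      ≡⟨ ∑G-cong (λ x → *-distribˡ-∑G (ι (inP j x)) (ι ∘ inP k)) ⟩
    ∑G (λ x → ∑G (λ y → ι (inP j x) * ι (inP k y)))
      ≡⟨ ∑G-cong (λ x → ∑G-cong λ y → ι-∧-interchange (R x) _ (R y) _) ⟩
    ∑G (λ x → ∑G (λ y → δ (proj₂ x) j * ι (R x ∧ R y ∧ ⌊ proj₂ y ≟ k ⌋))) ∎

∑-reps : ∀ {n p} (R : Subset n p) (c : Fin p) →
  ∑[ a < n + 2 ] reps R (a , c) ≡ pairsWith R (λ x y → not (eqG x y) ∧ ⌊ proj₂ x ⊖ proj₂ y ≟ c ⌋)
∑-reps {n} {p} R c = begin
  ∑[ a < n + 2 ] reps R (a , c)
    ≡⟨ sum-cong-≗ (λ a →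
         length-filterᵇ-elems² (λ x y → R x ∧ R y ∧ not (eqG x y) ∧ eqG (quot x y) (a , c))) ⟩
  ∑[ a < n + 2 ] ∑G (λ x → ∑G (λ y → ι (R x ∧ R y ∧ not (eqG x y) ∧ eqG (quot x y) (a , c))))
    ≡⟨ sum-cong-≗ (λ a → ∑G-cong λ x → ∑G-cong λ y →
         ι-∧-pull (R x) (R y) (not (eqG x y)) ⌊ proj₁ x ⊖ proj₁ y ≟ a ⌋ (D x y)) ⟩
  ∑[ a < n + 2 ] ∑G (λ x → ∑G (λ y → δ (proj₁ x ⊖ proj₁ y) a * ι (R x ∧ R y ∧ not (eqG x y) ∧ D x y)))
    ≡⟨ ∑-∑G²-δ (λ x y → proj₁ x ⊖ proj₁ y) (λ x y _ → ι (R x ∧ R y ∧ not (eqG x y) ∧ D x y)) ⟩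
  pairsWith R (λ x y → not (eqG x y) ∧ D x y) ∎
  where
  open ≡-Reasoning
  D : G n p → G n p → Bool
  D x y = ⌊ proj₂ x ⊖ proj₂ y ≟ c ⌋

module _ {n q : ℕ} (R : Subset n (suc q)) where

  pairsWith-diagonal : (c : Fin (suc q)) →
    pairsWith R (λ x y → ⌊ proj₂ x ⊖ proj₂ y ≟ c ⌋)
      ≡ pairsWith R (λ x y → not (eqG x y) ∧ ⌊ proj₂ x ⊖ proj₂ y ≟ c ⌋) + card R * ι ⌊ zero ≟ c ⌋
  pairsWith-diagonal c = begin
    pairsWith R D
      ≡⟨ ∑G-cong (λ x → ∑G-cong λ y → ι-split (R x) (R y) (eqG x y) (D x y)) ⟩
    ∑G (λ x → ∑G (λ y → off x y + on x y))
      ≡⟨ ∑G²-distrib-+ off on ⟩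
    pairsWith R (λ x y → not (eqG x y) ∧ D x y) + ∑G (λ x → ∑G (on x))
      ≡⟨ cong₂ _+_ refl diagonal ⟩
    pairsWith R (λ x y → not (eqG x y) ∧ D x y) + card R * ι ⌊ zero ≟ c ⌋ ∎
    where
    open ≡-Reasoning
    D : G n (suc q) → G n (suc q) → Bool
    D x y = ⌊ proj₂ x ⊖ proj₂ y ≟ c ⌋
    off on : G n (suc q) → G n (suc q) → ℕ
    off x y = ι (R x ∧ R y ∧ not (eqG x y) ∧ D x y)
    on  x y = ι (eqG x y) * ι (R x ∧ R y ∧ D x y)
    diagonal : ∑G (λ x → ∑G (on x)) ≡ card R * ι ⌊ zero ≟ c ⌋
    diagonal = begin
      ∑G (λ x → ∑G (on x))
        ≡⟨ ∑G-cong (λ x → ∑G-δ x (λ y → ι (R x ∧ R y ∧ D x y))) ⟩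
      ∑G (λ x → ι (R x ∧ R x ∧ D x x))
        ≡⟨ ∑G-cong (λ x → cong (λ d → ι (R x ∧ R x ∧ ⌊ d ≟ c ⌋)) (⊖-self (proj₂ x))) ⟩
      ∑G (λ x → ι (R x ∧ R x ∧ ⌊ zero ≟ c ⌋))
        ≡⟨ ∑G-cong (λ x → ι-∧-dup (R x) ⌊ zero ≟ c ⌋) ⟩
      ∑G (λ x → ι (R x) * ι ⌊ zero ≟ c ⌋)
        ≡⟨ *-distribʳ-∑G (ι ⌊ zero ≟ c ⌋) (ι ∘ R) ⟨
      ∑G (ι ∘ R) * ι ⌊ zero ≟ c ⌋
        ≡⟨ cong (_* ι ⌊ zero ≟ c ⌋) (length-filterᵇ-elems R) ⟨
      card R * ι ⌊ zero ≟ c ⌋ ∎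

  ∑-s*s-shift : (c : Fin (suc q)) →
    ∑[ j < suc q ] (s R j * s R (j ⊖ c)) ≡ ∑[ a < n + 2 ] reps R (a , c) + card R * ι ⌊ zero ≟ c ⌋
  ∑-s*s-shift c = begin
    ∑[ j < suc q ] (s R j * s R (j ⊖ c))
      ≡⟨ ∑-s*s R (_⊖ c) ⟩
    pairsWith R (λ x y → ⌊ proj₂ y ≟ proj₂ x ⊖ c ⌋)
      ≡⟨ pairsWith-cong R (λ x y → ⌊≟⊖⌋-swap (proj₂ x) (proj₂ y) c) ⟩
    pairsWith R (λ x y → ⌊ proj₂ x ⊖ proj₂ y ≟ c ⌋)
      ≡⟨ pairsWith-diagonal c ⟩
    pairsWith R (λ x y → not (eqG x y) ∧ ⌊ proj₂ x ⊖ proj₂ y ≟ c ⌋) + card R * ι ⌊ zero ≟ c ⌋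
      ≡⟨ cong (_+ card R * ι ⌊ zero ≟ c ⌋) (∑-reps R c) ⟨
    ∑[ a < n + 2 ] reps R (a , c) + card R * ι ⌊ zero ≟ c ⌋ ∎
    where open ≡-Reasoning

  ΣFin-s*s⊖suc : (i : Fin q) →
    ΣFin (suc q) (λ j → s R j * s R (j ⊖ suc i)) ≡ ∑[ a < n + 2 ] reps R (a , suc i)
  ΣFin-s*s⊖suc i = begin
    ΣFin (suc q) (λ j → s R j * s R (j ⊖ suc i))    ≡⟨ listSum-map-allFin (suc q) _ ⟩
    ∑[ j < suc q ] (s R j * s R (j ⊖ suc i))       ≡⟨ ∑-s*s-shift (suc i) ⟩
    ∑[ a < n + 2 ] reps R (a , suc i) + card R * 0 ≡⟨ cong₂ _+_ refl (*-zeroʳ (card R)) ⟩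
    ∑[ a < n + 2 ] reps R (a , suc i) + 0         ≡⟨ +-identityʳ _ ⟩
    ∑[ a < n + 2 ] reps R (a , suc i)             ∎
    where open ≡-Reasoning

  ΣFin-s² : ΣFin (suc q) (λ j → s R j * s R j) ≡ card R + ∑[ a < n + 2 ] reps R (a , zero)
  ΣFin-s² = begin
    ΣFin (suc q) (λ j → s R j * s R j)            ≡⟨ listSum-map-allFin (suc q) _ ⟩
    ∑[ j < suc q ] (s R j * s R j)
      ≡⟨ sum-cong-≗ (λ j → cong (λ t → s R j * s R t) (⊖-identityʳ j)) ⟨
    ∑[ j < suc q ] (s R j * s R (j ⊖ zero))       ≡⟨ ∑-s*s-shift zero ⟩
    ∑[ a < n + 2 ] reps R (a , zero) + card R * 1 ≡⟨ cong₂ _+_ refl (*-identityʳ (card R)) ⟩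
    ∑[ a < n + 2 ] reps R (a , zero) + card R     ≡⟨ +-comm _ (card R) ⟩
    card R + ∑[ a < n + 2 ] reps R (a , zero)     ∎
    where open ≡-Reasoning

reps-identity : ∀ {k q} (R : Subset (suc k) (suc q)) → reps {suc k} R (zero , zero) ≡ 0
reps-identity {k} {q} R =
  trans (length-filterᵇ-elems² {suc k} Q)
    (trans (∑G-cong {suc k} {g = λ _ → 0} no-pairs) (∑G-zero {suc k} {suc q}))
  where
  Q : G (suc k) (suc q) → G (suc k) (suc q) → Bool
  Q x y = R x ∧ R y ∧ not (eqG {suc k} x y) ∧ eqG {suc k} (quot {suc k} x y) (zero , zero)
  quot-identity : (x y : G (suc k) (suc q)) → eqG {suc k} (quot {suc k} x y) (zero , zero) ≡ eqG {suc k} x y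
  quot-identity (a , b) (a′ , b′) = cong₂ _∧_ (⌊⊖≟zero⌋ a a′) (⌊⊖≟zero⌋ b b′)
  no-pairs : (x : G (suc k) (suc q)) → ∑G {suc k} (λ y → ι (Q x y)) ≡ 0
  no-pairs x = trans (∑G-cong {suc k} {g = λ _ → 0} no-pair) (∑G-zero {suc k} {suc q})
    where
    no-pair : ∀ y → ι (Q x y) ≡ 0
    no-pair y rewrite quot-identity x y | ∧-inverseˡ (eqG {suc k} x y) | ∧-zeroʳ (R y) | ∧-zeroʳ (R x) = refl

∑-below-last : ∀ k (f : Fin (k + 2) → ℕ) {μ e : ℕ} →
  (∀ a → toℕ a ≤ k → f a ≡ μ) → (∀ a → toℕ a ≡ suc k → f a ≡ e) →
  ∑[ a < k + 2 ] f a ≡ suc k * μ + e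
∑-below-last zero    f {μ} below last =
  cong₂ _+_ (trans (below zero z≤n) (sym (+-identityʳ μ))) (trans (+-identityʳ _) (last (suc zero) refl))
∑-below-last (suc k) f {μ} {e} below last = trans
  (cong₂ _+_ (below zero z≤n)
    (∑-below-last k (f ∘ suc) (λ a a≤k → below (suc a) (s≤s a≤k)) (λ a eq → last (suc a) (cong suc eq))))
  (sym (+-assoc μ (suc k * μ) e))

∑-exponent-classes : ∀ m (f : Fin (suc m + 2) → ℕ) {c₀ e μ : ℕ} → f zero ≡ c₀ →
  (∀ a → Edge (suc m) (toℕ a) → f a ≡ e) → (∀ a → Mid (suc m) (toℕ a) → f a ≡ μ) →
  ∑[ a < suc m + 2 ] f a ≡ c₀ + (e + (m * μ + e))
∑-exponent-classes zero    f f₀ edge mid = cong₂ _+_ f₀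
  (cong₂ _+_ (edge (suc zero) (inj₁ refl)) (trans (+-identityʳ _) (edge (suc (suc zero)) (inj₂ refl))))
∑-exponent-classes (suc m) f f₀ edge mid = cong₂ _+_ f₀ (cong₂ _+_ (edge (suc zero) (inj₁ refl))
  (∑-below-last m (λ a → f (suc (suc a))) (λ a a≤m → mid (suc (suc a)) (s≤s (s≤s z≤n) , s≤s (s≤s a≤m)))
    (λ a eq → edge (suc (suc a)) (inj₂ (cong (λ t → suc (suc t)) eq)))))

module _ {m q k λ₁ λ₂ λ₃ μ₁ μ₂ : ℕ} {R : Subset (suc m) (suc q)}
         (pdpds : PDPDS (suc m) (suc q) k λ₁ λ₂ λ₃ μ₁ μ₂ R) where

  open PDPDS pdpds

  ∑-reps-coset : (c : Fin (suc q)) → toℕ c ≢ 0 →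
    ∑[ a < suc m + 2 ] reps {suc m} R (a , c) ≡ λ₂ + (μ₂ + (m * μ₁ + μ₂))
  ∑-reps-coset c c≢0 = ∑-exponent-classes m (λ a → reps {suc m} R (a , c)) (repλ₂ zero c refl c≢0)
    (λ a edge → repμ₂ a c edge c≢0) (λ a mid → repμ₁ a c mid c≢0)

  ∑-reps-H : ∑[ a < suc m + 2 ] reps {suc m} R (a , zero) ≡ λ₃ + (m * λ₁ + λ₃)
  ∑-reps-H = ∑-exponent-classes m (λ a → reps {suc m} R (a , zero)) (reps-identity R)
    (λ a edge → repλ₃ a zero edge refl) (λ a mid → repλ₁ a zero mid refl)

q*μ+λ≡k : ∀ q μ λ′ k c (γ : ℤ) →
  + suc q *ℤ + μ ≡ + (c + k) -ℤ γ -ℤ + c → + λ′ ≡ + μ +ℤ γ → q * μ + λ′ ≡ k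
q*μ+λ≡k q μ λ′ k c γ pμ≡ λ≡ = +-injective (begin
  + (q * μ + λ′)               ≡⟨ cong₂ _+ℤ_ (pos-* q μ) λ≡ ⟩
  + q *ℤ + μ +ℤ (+ μ +ℤ γ)     ≡⟨ ℤ-regroup (+ q) (+ μ) γ ⟩
  + suc q *ℤ + μ +ℤ γ          ≡⟨ cong (_+ℤ γ) pμ≡ ⟩
  + (c + k) -ℤ γ -ℤ + c +ℤ γ   ≡⟨ cong (λ t → t -ℤ γ -ℤ + c +ℤ γ) (pos-+ c k) ⟩
  + c +ℤ + k -ℤ γ -ℤ + c +ℤ γ  ≡⟨ ℤ-cancel (+ c) (+ k) γ ⟩
  + k                          ∎)
  where
  open ≡-Reasoning
  ℤ-regroup : ∀ Q M Γ → Q *ℤ M +ℤ (M +ℤ Γ) ≡ (+ 1 +ℤ Q) *ℤ M +ℤ Γ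
  ℤ-regroup = ℤ.solve-∀
  ℤ-cancel : ∀ C K Γ → C +ℤ K -ℤ Γ -ℤ C +ℤ Γ ≡ K
  ℤ-cancel = ℤ.solve-∀

weighted-count≡n² : ∀ m q λ₁ λ₃ μ₁ μ₂ → q * μ₁ + λ₁ ≡ m → q * μ₂ + λ₃ ≡ suc m →
  q * (μ₂ + (suc m * μ₁ + μ₂)) + (suc (suc m) + (λ₃ + (suc m * λ₁ + λ₃))) ≡ suc (suc m) * suc (suc m)
weighted-count≡n² m q λ₁ λ₃ μ₁ μ₂ h₁ h₃ = begin
  q * (μ₂ + (suc m * μ₁ + μ₂)) + (suc (suc m) + (λ₃ + (suc m * λ₁ + λ₃)))
    ≡⟨ regroup q μ₁ μ₂ λ₁ λ₃ (suc m) (suc (suc m)) ⟩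
  2 * (q * μ₂ + λ₃) + suc m * (q * μ₁ + λ₁) + suc (suc m)
    ≡⟨ cong₂ (λ a b → 2 * a + suc m * b + suc (suc m)) h₃ h₁ ⟩
  2 * suc m + suc m * m + suc (suc m)
    ≡⟨ square m ⟩
  suc (suc m) * suc (suc m) ∎
  where
  open ≡-Reasoning
  regroup : ∀ q μ₁ μ₂ λ₁ λ₃ M N → q * (μ₂ + (M * μ₁ + μ₂)) + (N + (λ₃ + (M * λ₁ + λ₃)))
    ≡ 2 * (q * μ₂ + λ₃) + M * (q * μ₁ + λ₁) + N
  regroup = ℕ.solve-∀
  square : ∀ m → 2 * suc m + suc m * m + suc (suc m) ≡ suc (suc m) * suc (suc m)
  square = ℕ.solve-∀

corollary4p2 : (p n : ℕ) → Prime p → 2 ≤ n → (γ₁ γ₂ : ℤ) → (R : Subset n p) →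
    (λ₁ λ₃ μ₁ μ₂ : ℕ) →
    (+ p) *ℤ (+ μ₁) ≡ (+ n) -ℤ γ₂ -ℤ (+ 2) → + λ₁ ≡ (+ μ₁) +ℤ γ₂ →
    (+ p) *ℤ (+ μ₂) ≡ (+ n) -ℤ γ₁ -ℤ (+ 1) → + λ₃ ≡ (+ μ₂) +ℤ γ₁ →
    PDPDS n p n λ₁ 0 λ₃ μ₁ μ₂ R →
    (i : Fin p) → 1 ≤ toℕ i → toℕ i ≤ ⌈ (p ∸ 1) /2⌉ →
    (p ∸ 1) * ΣFin p (λ j → s R j * s R (j ⊖ i)) + ΣFin p (λ j → s R j * s R j) ≡ n * n
corollary4p2 (suc q) n@(suc (suc m)) _ (s≤s (s≤s z≤n)) γ₁ γ₂ R λ₁ λ₃ μ₁ μ₂ pμ₁≡ λ₁≡ pμ₂≡ λ₃≡ pdpds (suc i) _ _ =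
  begin
    q * ΣFin (suc q) (λ j → s {n} R j * s {n} R (j ⊖ suc i)) + ΣFin (suc q) (λ j → s {n} R j * s {n} R j)
      ≡⟨ cong₂ (λ a b → q * a + b) (ΣFin-s*s⊖suc {n} R i) (ΣFin-s² {n} R) ⟩
    q * ∑[ a < n + 2 ] reps {n} R (a , suc i) + (card {n} R + ∑[ a < n + 2 ] reps {n} R (a , zero))
      ≡⟨ cong₂ (λ a b → q * a + b) (∑-reps-coset pdpds (suc i) λ ())
                                    (cong₂ _+_ (PDPDS.size pdpds) (∑-reps-H pdpds)) ⟩
    q * (μ₂ + (suc m * μ₁ + μ₂)) + (n + (λ₃ + (suc m * λ₁ + λ₃)))
      ≡⟨ weighted-count≡n² m q λ₁ λ₃ μ₁ μ₂ (q*μ+λ≡k q μ₁ λ₁ m 2 γ₂ pμ₁≡ λ₁≡)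
                                           (q*μ+λ≡k q μ₂ λ₃ (suc m) 1 γ₁ pμ₂≡ λ₃≡) ⟩
    n * n ∎
  where open ≡-Reasoning
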